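{- Let $G_1,G_2$ be finite simple graphs, where $G_l$ has order $n_l$, maximum degree $\Delta_l$ and minimum degree $\delta_l$, $l\in\{1,2\}$. Let $i,j\in\{1,2\}$ with $i\neq j$. Then for every integer $k\in\{2-\delta_j-\Delta_i,\dots,\Delta_i-\delta_j\}$, $$\phi_k^o(G_1\times G_2)\ge n_j\,\phi^o_{k+\delta_j}(G_i).$$
   Context: For a graph $G=(V,E)$, a set $S\subseteq V$ and $v\in V$, $\delta_S(v)=|\{u\in S: uv\in E\}|$, $\overline{S}=V\setminus S$, and $\partial S$ is the set of vertices of $\overline{S}$ adjacent to at least one vertex of $S$. For an integer $k$, a non-empty set $S\subseteq V$ is an offensive $k$-alliance if $\delta_S(v)\ge \delta_{\overline{S}}(v)+k$ for every $v\in \partial S$. A set $X\subseteq V$ is offensive $k$-alliance free ($k$-oaf) if $X$ contains no offensive $k$-alliance as a subset; $\phi_k^o(G)$ is the maximum cardinality of a $k$-oaf set in $G$. The Cartesian product $G_1\times G_2$ has vertex set $V_1\times V_2$, with $(a,b)$ adjacent to $(c,d)$ iff either $a=c$ and $bd\in E_2$, or $b=d$ and $ac\in E_1$. -}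

module Defs where

open import Data.Bool using (Bool; true; false; _∧_; _∨_)
open import Data.Nat using (ℕ; _*_; _≤_)
open import Data.Integer using (ℤ; +_)
import Data.Integer as ℤ
open import Data.Fin using (Fin; zero; suc; remQuot)
open import Data.Fin.Properties using (_≟_)
open import Data.Fin.Subset using (Subset; _∈_; _∉_; _⊆_; ∣_∣; Nonempty; ∁; _∩_)
open import Data.Vec using (tabulate)
open import Data.Product using (Σ; _×_; _,_; ∃)
open import Relation.Nullary using (¬_; yes; no)
open import Relation.Nullary.Decidable using (⌊_⌋)
open import Relation.Binary.PropositionalEquality using (_≡_; refl; cong₂)

record Graph : Set where
  field
    n      : ℕ
    adj    : Fin n → Fin n → Bool
    adj-sym    : ∀ u v → adj u v ≡ adj v u
    adj-irrefl : ∀ v → adj v v ≡ false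
open Graph public

N : (G : Graph) → Fin (n G) → Subset (n G)
N G v = tabulate (λ u → adj G v u)

deg : (G : Graph) → Fin (n G) → ℕ
deg G v = ∣ N G v ∣

IsMaxDegree : Graph → ℕ → Set
IsMaxDegree G d = (∃ λ v → deg G v ≡ d) × (∀ v → deg G v ≤ d)

IsMinDegree : Graph → ℕ → Set
IsMinDegree G d = (∃ λ v → deg G v ≡ d) × (∀ v → d ≤ deg G v)

δ[_] : (G : Graph) → Subset (n G) → Fin (n G) → ℕ
δ[ G ] S v = ∣ S ∩ N G v ∣

InBoundary : (G : Graph) → Subset (n G) → Fin (n G) → Set
InBoundary G S v = v ∉ S × Nonempty (S ∩ N G v)

IsOffensiveAlliance : (G : Graph) → ℤ → Subset (n G) → Set
IsOffensiveAlliance G k S =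
  Nonempty S ×
  (∀ v → InBoundary G S v →
     (+ (δ[ G ] (∁ S) v)) ℤ.+ k ℤ.≤ + (δ[ G ] S v))

IsOAF : (G : Graph) → ℤ → Subset (n G) → Set
IsOAF G k X = ∀ S → S ⊆ X → ¬ IsOffensiveAlliance G k S

IsPhiO : (G : Graph) → ℤ → ℕ → Set
IsPhiO G k m =
  (Σ (Subset (n G)) λ X → IsOAF G k X × ∣ X ∣ ≡ m) ×
  (∀ X → IsOAF G k X → ∣ X ∣ ≤ m)

eqb : ∀ {m} → Fin m → Fin m → Bool
eqb a c = ⌊ a ≟ c ⌋

eqb-sym : ∀ {m} (a c : Fin m) → eqb a c ≡ eqb c a
eqb-sym a c with a ≟ c | c ≟ a
... | yes _ | yes _ = refl
... | no _  | no _  = refl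
... | yes refl | no ¬p = Relation.Nullary.contradiction refl ¬p
  where import Relation.Nullary
... | no ¬p | yes refl = Relation.Nullary.contradiction refl ¬p
  where import Relation.Nullary

eqb-refl : ∀ {m} (a : Fin m) → eqb a a ≡ true
eqb-refl a with a ≟ a
... | yes _ = refl
... | no ¬p = Relation.Nullary.contradiction refl ¬p
  where import Relation.Nullary

prodAdj : (G₁ G₂ : Graph) → (Fin (n G₁) × Fin (n G₂)) → (Fin (n G₁) × Fin (n G₂)) → Bool
prodAdj G₁ G₂ (a , b) (c , d) = (eqb a c ∧ adj G₂ b d) ∨ (eqb b d ∧ adj G₁ a c)

prodAdj-sym : ∀ G₁ G₂ x y → prodAdj G₁ G₂ x y ≡ prodAdj G₁ G₂ y x
prodAdj-sym G₁ G₂ (a , b) (c , d) =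
  cong₂ _∨_ (cong₂ _∧_ (eqb-sym a c) (adj-sym G₂ b d))
            (cong₂ _∧_ (eqb-sym b d) (adj-sym G₁ a c))

prodAdj-irrefl : ∀ G₁ G₂ x → prodAdj G₁ G₂ x x ≡ false
prodAdj-irrefl G₁ G₂ (a , b)
  rewrite eqb-refl a | eqb-refl b | adj-irrefl G₁ a | adj-irrefl G₂ b = refl

-- Cartesian product G₁ × G₂; vertex (a , b) is encoded in Fin (n₁ * n₂)
-- via the bijection remQuot / combine.
_□_ : Graph → Graph → Graph
G₁ □ G₂ = record
  { n      = n G₁ * n G₂
  ; adj    = λ x y → prodAdj G₁ G₂ (remQuot (n G₂) x) (remQuot (n G₂) y)
  ; adj-sym    = λ x y → prodAdj-sym G₁ G₂ (remQuot (n G₂) x) (remQuot (n G₂) y)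
  ; adj-irrefl = λ x → prodAdj-irrefl G₁ G₂ (remQuot (n G₂) x)
  }

-- select G₁ or G₂ by an index in {1,2} (Fin 2: zero = 1, suc zero = 2)
pick : Graph → Graph → Fin 2 → Graph
pick G₁ G₂ zero    = G₁
pick G₁ G₂ (suc _) = G₂

module Submission where

-- Write H = G_i and K = G_j, and view each vertex of P = G₁ × G₂ as a pair
-- (h , c) with h ∈ V(H), c ∈ V(K).  Given a (k+δ)-oaf set X of H, the
-- cylinder X × V(K) has n_K · |X| vertices, and it is k-oaf in P: if
-- S ⊆ X × V(K) were an offensive k-alliance of P, its shadow
-- {h : (h , c) ∈ S for some c} ⊆ X would be an offensive (k+δ)-alliance of H.
-- The counting behind the last claim is one identity: the neighbours of
-- (v , c) inside a set S split into a row part (v , c') with c' ~ c and a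
-- column part (h , c) with h ~ v.  At a boundary vertex (v , c₀) of S lying
-- over a boundary vertex v of the shadow, the row of S is empty while the row
-- of the complement is all of V(K), contributing deg(c₀) ≥ δ extra outside
-- neighbours; this is exactly the shift from k to k + δ.

open import Defs
open import Data.Nat using (ℕ; _*_; _≤_)
open import Data.Integer using (ℤ; +_; _-_)
import Data.Integer as ℤ
open import Data.Fin using (Fin)
open import Relation.Binary.PropositionalEquality using (_≢_)

import Data.Nat as ℕ
import Data.Nat.Properties as ℕₚ
import Data.Integer.Properties as ℤₚ
open import Data.Bool using (Bool; true; false; _∧_; _∨_)
open import Data.Bool.Properties using (T-≡; ∨-comm; ∨-zeroʳ)
open import Data.Fin using (zero; suc; combine; remQuot; _↑ˡ_; _↑ʳ_; punchIn)
open import Data.Fin.Properties using (_≟_; remQuot-combine; combine-remQuot; punchInᵢ≢i; any?)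
open import Data.Fin.Subset using (Subset; ⊥; _∈_; _∉_; _⊆_; ∣_∣; ∁; _∩_)
open import Data.Fin.Subset.Properties
  using (_∈?_; x∈p∩q⁺; x∈p∩q⁻; x∈∁p⇒x∉p; x∉p⇒x∈∁p; p⊆q⇒∣p∣≤∣q∣; ∣⊥∣≡0)
open import Data.Vec using ([]; _∷_; lookup; tabulate)
open import Data.Vec.Properties using (lookup∘tabulate; lookup-zipWith; []=⇒lookup; lookup⇒[]=)
open import Data.Product using (_×_; _,_; ∃; proj₁; proj₂; uncurry; swap)
open import Function.Bundles using (Equivalence)
open import Relation.Nullary using (contradiction; yes; no)
open import Relation.Nullary.Decidable using (⌊_⌋; toWitness; fromWitness)
open import Relation.Binary.PropositionalEquality
  using (_≡_; refl; sym; trans; cong; cong₂; subst; module ≡-Reasoning)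
open import Algebra.Properties.CommutativeMonoid.Sum ℕₚ.+-0-commutativeMonoid
  using (sum; sum-syntax; sum-cong-≗; sum-remove; sum-replicate-zero; ∑-distrib-+; ∑-comm)

𝟙 : Bool → ℕ
𝟙 true  = 1
𝟙 false = 0

sum-↑ : ∀ a b (f : Fin (a ℕ.+ b) → ℕ) →
        ∑[ y < a ℕ.+ b ] f y ≡ ∑[ i < a ] f (i ↑ˡ b) ℕ.+ ∑[ j < b ] f (a ↑ʳ j)
sum-↑ ℕ.zero    b f = refl
sum-↑ (ℕ.suc a) b f = trans (cong (f zero ℕ.+_) (sum-↑ a b (λ y → f (suc y))))
                            (sym (ℕₚ.+-assoc (f zero) _ _))

sum-combine : ∀ m n (f : Fin (m * n) → ℕ) →
              ∑[ y < m * n ] f y ≡ ∑[ h < m ] ∑[ c < n ] f (combine h c)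
sum-combine ℕ.zero    n f = refl
sum-combine (ℕ.suc m) n f =
  trans (sum-↑ n (m * n) f)
        (cong (∑[ c < n ] f (c ↑ˡ (m * n)) ℕ.+_) (sum-combine m n (λ y → f (n ↑ʳ y))))

∑-const : ∀ m c → ∑[ i < m ] c ≡ m * c
∑-const ℕ.zero    c = refl
∑-const (ℕ.suc m) c = cong (c ℕ.+_) (∑-const m c)

eqb-≢ : ∀ {m} {a c : Fin m} → a ≢ c → eqb a c ≡ false
eqb-≢ {a = a} {c} a≢c with a ≟ c
... | yes a≡c = contradiction a≡c a≢c
... | no _    = refl

∑-kronecker : ∀ {m} (i : Fin m) (g : Fin m → ℕ) →
              ∑[ j < m ] (𝟙 (eqb i j) * g j) ≡ g i
∑-kronecker {ℕ.suc m} i g = begin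
  ∑[ j < ℕ.suc m ] (𝟙 (eqb i j) * g j)
    ≡⟨ sum-remove {i = i} (λ j → 𝟙 (eqb i j) * g j) ⟩
  𝟙 (eqb i i) * g i ℕ.+ ∑[ j < m ] (𝟙 (eqb i (punchIn i j)) * g (punchIn i j))
    ≡⟨ cong₂ ℕ._+_ (cong (λ b → 𝟙 b * g i) (eqb-refl i)) (sum-cong-≗ off-diagonal) ⟩
  1 * g i ℕ.+ ∑[ j < m ] 0
    ≡⟨ cong₂ ℕ._+_ (ℕₚ.*-identityˡ (g i)) (sum-replicate-zero m) ⟩
  g i ℕ.+ 0
    ≡⟨ ℕₚ.+-identityʳ (g i) ⟩
  g i ∎
  where
  open ≡-Reasoning
  off-diagonal : ∀ j → 𝟙 (eqb i (punchIn i j)) * g (punchIn i j) ≡ 0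
  off-diagonal j rewrite eqb-≢ (λ e → punchInᵢ≢i i j (sym e)) = refl

card-sum : ∀ {m} (p : Subset m) → ∣ p ∣ ≡ ∑[ i < m ] 𝟙 (lookup p i)
card-sum []          = refl
card-sum (true  ∷ p) = cong ℕ.suc (card-sum p)
card-sum (false ∷ p) = card-sum p

∈-tabulate⁺ : ∀ {m} {f : Fin m → Bool} {x} → f x ≡ true → x ∈ tabulate f
∈-tabulate⁺ {f = f} {x} e = lookup⇒[]= x (tabulate f) (trans (lookup∘tabulate f x) e)

∈-tabulate⁻ : ∀ {m} {f : Fin m → Bool} {x} → x ∈ tabulate f → f x ≡ true
∈-tabulate⁻ {f = f} {x} x∈ = trans (sym (lookup∘tabulate f x)) ([]=⇒lookup x∈)

preimage : ∀ {l m} → (Fin l → Fin m) → Subset m → Subset l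
preimage f p = tabulate (λ y → lookup p (f y))

∈-preimage⁺ : ∀ {l m} {f : Fin l → Fin m} {p} {y} → f y ∈ p → y ∈ preimage f p
∈-preimage⁺ fy∈ = ∈-tabulate⁺ ([]=⇒lookup fy∈)

∈-preimage⁻ : ∀ {l m} {f : Fin l → Fin m} {p} {y} → y ∈ preimage f p → f y ∈ p
∈-preimage⁻ {f = f} {p} {y} y∈ = lookup⇒[]= (f y) p (∈-tabulate⁻ y∈)

δ-tabulate : ∀ G (f : Fin (n G) → Bool) v →
             δ[ G ] (tabulate f) v ≡ ∑[ u < n G ] 𝟙 (f u ∧ adj G v u)
δ-tabulate G f v = trans (card-sum (tabulate f ∩ N G v)) (sum-cong-≗ λ u → cong 𝟙 (
  trans (lookup-zipWith _∧_ u (tabulate f) (N G v))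
        (cong₂ _∧_ (lookup∘tabulate f u) (lookup∘tabulate (adj G v) u))))

δ-sum : ∀ G (S : Subset (n G)) v → δ[ G ] S v ≡ ∑[ u < n G ] 𝟙 (lookup S u ∧ adj G v u)
δ-sum G S v = trans (card-sum (S ∩ N G v)) (sum-cong-≗ λ u → cong 𝟙 (
  trans (lookup-zipWith _∧_ u S (N G v)) (cong (lookup S u ∧_) (lookup∘tabulate (adj G v) u))))

δ-mono : ∀ G {S S' : Subset (n G)} v → S ⊆ S' → δ[ G ] S v ≤ δ[ G ] S' v
δ-mono G {S} {S'} v S⊆S' = p⊆q⇒∣p∣≤∣q∣ λ {u} u∈ →
  let (u∈S , u∈N) = x∈p∩q⁻ S (N G v) u∈ in x∈p∩q⁺ (S⊆S' u∈S , u∈N)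

deg≤δ : ∀ G {S : Subset (n G)} v → (∀ u → u ∈ S) → deg G v ≤ δ[ G ] S v
deg≤δ G {S} v all∈ = p⊆q⇒∣p∣≤∣q∣ λ {u} u∈N → x∈p∩q⁺ (all∈ u , u∈N)

δ-empty : ∀ G {S : Subset (n G)} v → (∀ u → u ∉ S) → δ[ G ] S v ≡ 0
δ-empty G {S} v none = ℕₚ.n≤0⇒n≡0 (ℕₚ.≤-trans
  (p⊆q⇒∣p∣≤∣q∣ {q = ⊥} λ {u} u∈ → contradiction (proj₁ (x∈p∩q⁻ S (N G v) u∈)) (none u))
  (ℕₚ.≤-reflexive (∣⊥∣≡0 (n G))))

record ProductView (H K P : Graph) : Set where
  field
    enc        : Fin (n H) → Fin (n K) → Fin (n P)
    coords     : Fin (n P) → Fin (n H) × Fin (n K)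
    enc-coords : ∀ y → uncurry enc (coords y) ≡ y
    coords-enc : ∀ h c → coords (enc h c) ≡ (h , c)
    sum-enc    : ∀ (f : Fin (n P) → ℕ) →
                 ∑[ y < n P ] f y ≡ ∑[ h < n H ] ∑[ c < n K ] f (enc h c)
    adj-enc    : ∀ h c h' c' → adj P (enc h c) (enc h' c') ≡
                   (eqb h h' ∧ adj K c c') ∨ (eqb c c' ∧ adj H h h')

□-view : ∀ G₁ G₂ → ProductView G₁ G₂ (G₁ □ G₂)
□-view G₁ G₂ = record
  { enc        = combine
  ; coords     = remQuot (n G₂)
  ; enc-coords = combine-remQuot {n G₁} (n G₂)
  ; coords-enc = remQuot-combine
  ; sum-enc    = sum-combine (n G₁) (n G₂)
  ; adj-enc    = λ h c h' c' →
      cong₂ (prodAdj G₁ G₂) (remQuot-combine h c) (remQuot-combine h' c')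
  }

□-view-swapped : ∀ G₁ G₂ → ProductView G₂ G₁ (G₁ □ G₂)
□-view-swapped G₁ G₂ = record
  { enc        = λ h c → combine c h
  ; coords     = λ y → swap (remQuot (n G₂) y)
  ; enc-coords = combine-remQuot {n G₁} (n G₂)
  ; coords-enc = λ h c → cong swap (remQuot-combine c h)
  ; sum-enc    = λ f → trans (sum-combine (n G₁) (n G₂) f)
                             (∑-comm {n G₁} {n G₂} (λ c h → f (combine c h)))
  ; adj-enc    = λ h c h' c' → trans
      (cong₂ (prodAdj G₁ G₂) (remQuot-combine c h) (remQuot-combine c' h'))
      (∨-comm (eqb c c' ∧ adj G₂ h h') (eqb h h' ∧ adj G₁ c c'))
  }

-- a vertex is never adjacent to itself, so the two product edge types are disjoint
loopless : ∀ G (c c' : Fin (n G)) → eqb c c' ∧ adj G c c' ≡ false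
loopless G c c' with c ≟ c'
... | yes refl = adj-irrefl G c
... | no _     = refl

𝟙-guarded-∨ : ∀ e₁ e₂ s a b → e₂ ∧ a ≡ false →
              𝟙 (s ∧ ((e₁ ∧ a) ∨ (e₂ ∧ b))) ≡ 𝟙 e₁ * 𝟙 (s ∧ a) ℕ.+ 𝟙 e₂ * 𝟙 (s ∧ b)
𝟙-guarded-∨ false false false _     _     _  = refl
𝟙-guarded-∨ false true  false _     _     _  = refl
𝟙-guarded-∨ true  false false _     _     _  = refl
𝟙-guarded-∨ true  true  false _     _     _  = refl
𝟙-guarded-∨ false false true  _     _     _  = refl
𝟙-guarded-∨ true  false true  false _     _  = refl
𝟙-guarded-∨ true  false true  true  _     _  = refl
𝟙-guarded-∨ false true  true  _     false _  = refl
𝟙-guarded-∨ false true  true  _     true  _  = refl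
𝟙-guarded-∨ true  true  true  false false _  = refl
𝟙-guarded-∨ true  true  true  false true  _  = refl
𝟙-guarded-∨ true  true  true  true  _     ()

module Product {H K P : Graph} (V : ProductView H K P) where
  open ProductView V

  row : Subset (n P) → Fin (n H) → Subset (n K)
  row S v = preimage (enc v) S

  col : Subset (n P) → Fin (n K) → Subset (n H)
  col S c = preimage (λ h → enc h c) S

  δ-row-col : ∀ S v c → δ[ P ] S (enc v c) ≡ δ[ K ] (row S v) c ℕ.+ δ[ H ] (col S c) v
  δ-row-col S v c = begin
    δ[ P ] S (enc v c)
      ≡⟨ trans (δ-sum P S (enc v c)) (sum-enc _) ⟩
    ∑[ h < n H ] ∑[ c' < n K ] 𝟙 (s h c' ∧ adj P (enc v c) (enc h c'))
      ≡⟨ sum-cong-≗ (λ h → sum-cong-≗ (λ c' → split h c')) ⟩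
    ∑[ h < n H ] ∑[ c' < n K ] (row-term h c' ℕ.+ column-term h c')
      ≡⟨ trans (sum-cong-≗ (λ h → ∑-distrib-+ (row-term h) (column-term h)))
               (∑-distrib-+ (λ h → sum (row-term h)) (λ h → sum (column-term h))) ⟩
    ∑[ h < n H ] ∑[ c' < n K ] row-term h c' ℕ.+ ∑[ h < n H ] ∑[ c' < n K ] column-term h c'
      ≡⟨ cong₂ ℕ._+_ (trans (∑-comm row-term) (sum-cong-≗ (λ c' → ∑-kronecker v (λ h → row-edge h c'))))
                     (sum-cong-≗ (λ h → ∑-kronecker c (column-edge h))) ⟩
    ∑[ c' < n K ] row-edge v c' ℕ.+ ∑[ h < n H ] column-edge h c
      ≡⟨ sym (cong₂ ℕ._+_ (δ-tabulate K _ c) (δ-tabulate H _ v)) ⟩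
    δ[ K ] (row S v) c ℕ.+ δ[ H ] (col S c) v ∎
    where
    open ≡-Reasoning
    s : Fin (n H) → Fin (n K) → Bool
    s h c' = lookup S (enc h c')
    row-edge column-edge : Fin (n H) → Fin (n K) → ℕ
    row-edge    h c' = 𝟙 (s h c' ∧ adj K c c')
    column-edge h c' = 𝟙 (s h c' ∧ adj H v h)
    row-term column-term : Fin (n H) → Fin (n K) → ℕ
    row-term    h c' = 𝟙 (eqb v h) * row-edge h c'
    column-term h c' = 𝟙 (eqb c c') * column-edge h c'
    split : ∀ h c' → 𝟙 (s h c' ∧ adj P (enc v c) (enc h c')) ≡ row-term h c' ℕ.+ column-term h c'
    split h c' rewrite adj-enc v c h c' =
      𝟙-guarded-∨ (eqb v h) (eqb c c') (s h c') (adj K c c') (adj H v h) (loopless K c c')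

  cylinder : Subset (n H) → Subset (n P)
  cylinder X = preimage (λ y → proj₁ (coords y)) X

  ∣cylinder∣ : ∀ X → ∣ cylinder X ∣ ≡ n K * ∣ X ∣
  ∣cylinder∣ X = begin
    ∣ cylinder X ∣
      ≡⟨ trans (card-sum (cylinder X)) (sum-cong-≗ (λ y → cong 𝟙 (lookup∘tabulate fst∈X y))) ⟩
    ∑[ y < n P ] 𝟙 (fst∈X y)
      ≡⟨ sum-enc (λ y → 𝟙 (fst∈X y)) ⟩
    ∑[ h < n H ] ∑[ c < n K ] 𝟙 (fst∈X (enc h c))
      ≡⟨ sum-cong-≗ (λ h → sum-cong-≗ (λ c →
           cong (λ q → 𝟙 (lookup X (proj₁ q))) (coords-enc h c))) ⟩
    ∑[ h < n H ] ∑[ c < n K ] 𝟙 (lookup X h)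
      ≡⟨ trans (∑-comm {n H} {n K} (λ h c → 𝟙 (lookup X h)))
               (∑-const (n K) (∑[ h < n H ] 𝟙 (lookup X h))) ⟩
    n K * ∑[ h < n H ] 𝟙 (lookup X h)
      ≡⟨ cong (n K *_) (sym (card-sum X)) ⟩
    n K * ∣ X ∣ ∎
    where
    open ≡-Reasoning
    fst∈X : Fin (n P) → Bool
    fst∈X y = lookup X (proj₁ (coords y))

  ∈-cylinder⁻ : ∀ {X h c} → enc h c ∈ cylinder X → h ∈ X
  ∈-cylinder⁻ {X} {h} {c} e = subst (_∈ X) (cong proj₁ (coords-enc h c)) (∈-preimage⁻ e)

  shadow : Subset (n P) → Subset (n H)
  shadow S = tabulate (λ h → ⌊ any? (λ c → enc h c ∈? S) ⌋)

  ∈-shadow⁺ : ∀ {S h c} → enc h c ∈ S → h ∈ shadow S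
  ∈-shadow⁺ {S} {h} {c} e =
    ∈-tabulate⁺ (Equivalence.to T-≡ (fromWitness {a? = any? (λ c → enc h c ∈? S)} (c , e)))

  ∈-shadow⁻ : ∀ {S h} → h ∈ shadow S → ∃ λ c → enc h c ∈ S
  ∈-shadow⁻ {S} {h} h∈ =
    toWitness {a? = any? (λ c → enc h c ∈? S)} (Equivalence.from T-≡ (∈-tabulate⁻ h∈))

  lift-edge : ∀ {v h} c → adj H v h ≡ true → adj P (enc v c) (enc h c) ≡ true
  lift-edge {v} {h} c v~h = begin
    adj P (enc v c) (enc h c)                     ≡⟨ adj-enc v c h c ⟩
    (eqb v h ∧ adj K c c) ∨ (eqb c c ∧ adj H v h) ≡⟨ cong₂ (λ a b → (eqb v h ∧ adj K c c) ∨ (a ∧ b))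
                                                           (eqb-refl c) v~h ⟩
    (eqb v h ∧ adj K c c) ∨ true                  ≡⟨ ∨-zeroʳ _ ⟩
    true                                          ∎
    where open ≡-Reasoning

  -- If the row of v misses S, the S-neighbours of (v , c₀) all lie in its
  -- column, hence over S-shadow neighbours of v.
  inside-count : ∀ S v c₀ → (∀ c → enc v c ∉ S) → δ[ P ] S (enc v c₀) ≤ δ[ H ] (shadow S) v
  inside-count S v c₀ row-misses = begin
    δ[ P ] S (enc v c₀)                          ≡⟨ δ-row-col S v c₀ ⟩
    δ[ K ] (row S v) c₀ ℕ.+ δ[ H ] (col S c₀) v  ≡⟨ cong (ℕ._+ δ[ H ] (col S c₀) v) empty-row ⟩
    δ[ H ] (col S c₀) v                          ≤⟨ δ-mono H v (λ e → ∈-shadow⁺ (∈-preimage⁻ e)) ⟩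
    δ[ H ] (shadow S) v                          ∎
    where
    open ℕₚ.≤-Reasoning
    empty-row : δ[ K ] (row S v) c₀ ≡ 0
    empty-row = δ-empty K c₀ (λ c c∈ → row-misses c (∈-preimage⁻ c∈))

  -- If the row of v misses S, the complement of S contains the whole row
  -- (deg c₀ neighbours) and, in the column, everything over the complement of
  -- the shadow.
  outside-count : ∀ S v c₀ → (∀ c → enc v c ∉ S) →
                  δ[ H ] (∁ (shadow S)) v ℕ.+ deg K c₀ ≤ δ[ P ] (∁ S) (enc v c₀)
  outside-count S v c₀ row-misses = begin
    δ[ H ] (∁ (shadow S)) v ℕ.+ deg K c₀
      ≤⟨ ℕₚ.+-mono-≤ (δ-mono H v outside-column) (deg≤δ K c₀ full-row) ⟩
    δ[ H ] (col (∁ S) c₀) v ℕ.+ δ[ K ] (row (∁ S) v) c₀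
      ≡⟨ ℕₚ.+-comm (δ[ H ] (col (∁ S) c₀) v) (δ[ K ] (row (∁ S) v) c₀) ⟩
    δ[ K ] (row (∁ S) v) c₀ ℕ.+ δ[ H ] (col (∁ S) c₀) v
      ≡⟨ δ-row-col (∁ S) v c₀ ⟨
    δ[ P ] (∁ S) (enc v c₀) ∎
    where
    open ℕₚ.≤-Reasoning
    full-row : ∀ c → c ∈ row (∁ S) v
    full-row c = ∈-preimage⁺ (x∉p⇒x∈∁p (row-misses c))
    outside-column : ∁ (shadow S) ⊆ col (∁ S) c₀
    outside-column h∈ = ∈-preimage⁺ (x∉p⇒x∈∁p λ e → x∈∁p⇒x∉p h∈ (∈-shadow⁺ e))

  shadow-alliance : ∀ {δ} → (∀ c → δ ≤ deg K c) → ∀ k S →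
                    IsOffensiveAlliance P k S → IsOffensiveAlliance H (k ℤ.+ + δ) (shadow S)
  shadow-alliance {δ} δ≤deg k S ((y , y∈S) , offensive) =
    (proj₁ (coords y) , ∈-shadow⁺ (subst (_∈ S) (sym (enc-coords y)) y∈S)) , on-boundary
    where
    on-boundary : ∀ v → InBoundary H (shadow S) v →
                  + (δ[ H ] (∁ (shadow S)) v) ℤ.+ (k ℤ.+ + δ) ℤ.≤ + (δ[ H ] (shadow S) v)
    on-boundary v (v∉ , (h , h∈)) = begin
      + out ℤ.+ (k ℤ.+ + δ)      ≡⟨ cong (ℤ._+_ (+ out)) (ℤₚ.+-comm k (+ δ)) ⟩
      + out ℤ.+ (+ δ ℤ.+ k)      ≡⟨ ℤₚ.+-assoc (+ out) (+ δ) k ⟨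
      + (out ℕ.+ δ) ℤ.+ k        ≤⟨ ℤₚ.+-monoˡ-≤ k (ℤ.+≤+ outside) ⟩
      + (δ[ P ] (∁ S) x) ℤ.+ k   ≤⟨ offensive x (row-misses c₀ , (enc h c₀ , x-sees-S)) ⟩
      + (δ[ P ] S x)             ≤⟨ ℤ.+≤+ (inside-count S v c₀ row-misses) ⟩
      + (δ[ H ] (shadow S) v)    ∎
      where
      open ℤₚ.≤-Reasoning
      out : ℕ
      out = δ[ H ] (∁ (shadow S)) v
      h∈shadow×N : h ∈ shadow S × h ∈ N H v
      h∈shadow×N = x∈p∩q⁻ (shadow S) (N H v) h∈
      c₀ : Fin (n K)
      c₀ = proj₁ (∈-shadow⁻ (proj₁ h∈shadow×N))
      x : Fin (n P)
      x = enc v c₀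
      row-misses : ∀ c → enc v c ∉ S
      row-misses c e = v∉ (∈-shadow⁺ e)
      x-sees-S : enc h c₀ ∈ S ∩ N P x
      x-sees-S = x∈p∩q⁺ ( proj₂ (∈-shadow⁻ (proj₁ h∈shadow×N))
                        , ∈-tabulate⁺ (lift-edge c₀ (∈-tabulate⁻ (proj₂ h∈shadow×N))))
      outside : out ℕ.+ δ ≤ δ[ P ] (∁ S) x
      outside = ℕₚ.≤-trans (ℕₚ.+-monoʳ-≤ _ (δ≤deg c₀)) (outside-count S v c₀ row-misses)

  cylinder-oaf : ∀ {δ} → (∀ c → δ ≤ deg K c) → ∀ k X →
                 IsOAF H (k ℤ.+ + δ) X → IsOAF P k (cylinder X)
  cylinder-oaf δ≤deg k X X-oaf S S⊆cylinder S-alliance =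
    X-oaf (shadow S) shadow⊆X (shadow-alliance δ≤deg k S S-alliance)
    where
    shadow⊆X : shadow S ⊆ X
    shadow⊆X h∈ = ∈-cylinder⁻ (S⊆cylinder (proj₂ (∈-shadow⁻ h∈)))

  φ-lower-bound : ∀ {δ} → (∀ c → δ ≤ deg K c) → ∀ k {φ ψ} →
                  IsPhiO P k φ → IsPhiO H (k ℤ.+ + δ) ψ → n K * ψ ≤ φ
  φ-lower-bound δ≤deg k {φ} (_ , maximal) ((X , X-oaf , refl) , _) =
    subst (_≤ φ) (∣cylinder∣ X) (maximal (cylinder X) (cylinder-oaf δ≤deg k X X-oaf))

-- With H = G_i and K = G_j, the bound follows from the
-- product view of G₁ × G₂ with G_i as first factor.

corollary11 : (G₁ G₂ : Graph) (i j : Fin 2) → i ≢ j →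
    (Δᵢ δⱼ : ℕ) → IsMaxDegree (pick G₁ G₂ i) Δᵢ → IsMinDegree (pick G₁ G₂ j) δⱼ →
    (k : ℤ) → (+ 2 - + δⱼ) - + Δᵢ ℤ.≤ k → k ℤ.≤ + Δᵢ - + δⱼ →
    (φ ψ : ℕ) → IsPhiO (G₁ □ G₂) k φ → IsPhiO (pick G₁ G₂ i) (k ℤ.+ + δⱼ) ψ →
    n (pick G₁ G₂ j) * ψ ≤ φ
corollary11 G₁ G₂ zero       zero       i≢j = contradiction refl i≢j
corollary11 G₁ G₂ (suc zero) (suc zero) i≢j = contradiction refl i≢j
corollary11 G₁ G₂ zero       (suc zero) _ _ _ _ (_ , δ≤deg) k _ _ _ _ =
  Product.φ-lower-bound (□-view G₁ G₂) δ≤deg k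
corollary11 G₁ G₂ (suc zero) zero       _ _ _ _ (_ , δ≤deg) k _ _ _ _ =
  Product.φ-lower-bound (□-view-swapped G₁ G₂) δ≤deg k
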